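{- Let $T$ be a tetrahedron in $PG(3,2)$. Let $D_1$ and $D_2$ be decollineators and let $Q$ be a $(2,2)$-pole all of whose transitions lie in $\mathcal{Q}=\{\mathtt{hl}\to\mathtt{hl},\ \mathtt{ls}\to\mathtt{ls},\ \mathtt{alt}\to\mathtt{alt},\ \mathtt{ang}\to\mathtt{ls},\ \mathtt{ls}\to\mathtt{ang}\}$. Then every transition through $D_1\circ Q\circ D_2$ is one of $$\mathtt{ls}\to\mathtt{ang},\quad \mathtt{ang}\to\mathtt{ls},\quad \mathtt{ang}\to\mathtt{ang},\quad \mathtt{alt}\to\mathtt{alt}.$$ In particular, $D_1\circ Q\circ D_2$ is a heavy $(2,2)$-pole.
   Context: A multipole is like a graph but may have dangling edges (edges with one end incident with a vertex and the other end free); all multipoles are cubic. A $(2,2)$-pole is a multipole with four dangling edges partitioned into an input connector $I=(g_1,g_2)$ and an output connector $O=(h_1,h_2)$, each with a fixed linear order. The composition $M_1\circ M_2$ of $(2,2)$-poles is obtained by joining, for $i=1,2$, the free end of the $i$-th output dangling edge of $M_1$ with the free end of the $i$-th input dangling edge of $M_2$ into a single edge; its input connector is that of $M_1$ and its output connector that of $M_2$. $PG(3,2)$: points are the nonzero vectors of $\mathbb{F}_2^4$; lines are triples $\{x,y,z\}$ of points with $x+y+z=0$. A tetrahedron $T$ is determined by four points $p_1,\dots,p_4$ forming a basis of $\mathbb{F}_2^4$ (corner points, weight $1$); its other points are the six midpoints $c_1+c_2$ for distinct corner points (weight $2$); its lines are the six triples $\{c_1,c_2,c_1+c_2\}$.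 A $T$-flow on a multipole is a map $\phi$ from its edges (including dangling edges) to points of $T$ such that at each vertex the three incident edge values form a line of $T$. Shapes of pairs of points of $T$ ($c_i$ distinct corner points): $\mathtt{ls}=\{c_1,c_2\}$; $\mathtt{hl}=\{c_1,c_1+c_2\}$; $\mathtt{ang}=\{c_1+c_2,c_1+c_3\}$; $\mathtt{alt}=\{c_1,c_2+c_3\}$; $\mathtt{ax}=\{c_1+c_2,c_3+c_4\}$; $\mathtt{dpt}=\{x,x\}$. A $(2,2)$-pole $X$ has a transition $\mathtt{s}\to\mathtt{t}$ if some $T$-flow $\phi$ on $X$ has $\{\phi(g_1),\phi(g_2)\}$ of shape $\mathtt{s}$ and $\{\phi(h_1),\phi(h_2)\}$ of shape $\mathtt{t}$. A decollineator is a $(2,2)$-pole admitting no $T$-flow for which both the input pair and the output pair have shape $\mathtt{ls}$ or $\mathtt{hl}$ (i.e. both are collinear). A $(2,2)$-pole is heavy if for every $T$-flow on it at least two of its four dangling edges receive a value of weight $2$ (a midpoint). -}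

module Defs where

open import Data.Nat using (ℕ; zero; suc; _+_)
open import Data.Bool using (Bool; true; false; _xor_; if_then_else_)
open import Data.Fin using (Fin; zero; suc; _↑ˡ_; _↑ʳ_; splitAt)
open import Data.Fin.Properties renaming (_≟_ to _≟F_)
open import Data.Vec using (Vec; zipWith; replicate)
open import Data.Sum using (_⊎_; inj₁; inj₂)
import Data.Sum.Properties as SumP
open import Data.Product using (Σ; Σ-syntax; _×_; _,_)
open import Relation.Binary.PropositionalEquality using (_≡_; _≢_)
open import Relation.Nullary using (¬_; yes; no)
open import Relation.Nullary.Decidable using (⌊_⌋)
open import Relation.Binary.Definitions using (DecidableEquality)

-- PG(3,2): points are nonzero vectors of F₂⁴ (Bool with xor as +).
-- All points we use are points of a tetrahedron, which are nonzero
-- automatically (basis vectors and sums of two distinct basis vectors).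

Vec4 : Set
Vec4 = Vec Bool 4

_⊕_ : Vec4 → Vec4 → Vec4
_⊕_ = zipWith _xor_

𝟎 : Vec4
𝟎 = replicate 4 false

lincomb : (Fin 4 → Bool) → (Fin 4 → Vec4) → Vec4
lincomb s p = sc (s zero) (p zero) ⊕ (sc (s (suc zero)) (p (suc zero))
            ⊕ (sc (s (suc (suc zero))) (p (suc (suc zero)))
            ⊕ sc (s (suc (suc (suc zero)))) (p (suc (suc (suc zero))))))
  where
  sc : Bool → Vec4 → Vec4
  sc b v = if b then v else 𝟎

record Tetrahedron : Set where
  field
    corner : Fin 4 → Vec4
    indep  : (s : Fin 4 → Bool) → lincomb s corner ≡ 𝟎 → (i : Fin 4) → s i ≡ false
open Tetrahedron public

module _ (T : Tetrahedron) where
  private p = corner T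

  IsMidpoint : Vec4 → Set
  IsMidpoint x = Σ[ i ∈ Fin 4 ] Σ[ j ∈ Fin 4 ] (i ≢ j × x ≡ p i ⊕ p j)

  IsPointOf : Vec4 → Set
  IsPointOf x = (Σ[ i ∈ Fin 4 ] x ≡ p i) ⊎ IsMidpoint x

  IsLineOf : Vec4 → Vec4 → Vec4 → Set
  IsLineOf a b c = Σ[ i ∈ Fin 4 ] Σ[ j ∈ Fin 4 ] (i ≢ j ×
      ( (a ≡ p i ⊕ p j × b ≡ p i × c ≡ p j)
      ⊎ (b ≡ p i ⊕ p j × a ≡ p i × c ≡ p j)
      ⊎ (c ≡ p i ⊕ p j × a ≡ p i × b ≡ p j)))

data Shape : Set where
  ls hl ang alt ax dpt : Shape

module _ (T : Tetrahedron) where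
  private p = corner T

  HasShape : Shape → Vec4 → Vec4 → Set
  HasShape ls x y = Σ[ i ∈ Fin 4 ] Σ[ j ∈ Fin 4 ] (i ≢ j × x ≡ p i × y ≡ p j)
  HasShape hl x y = Σ[ i ∈ Fin 4 ] Σ[ j ∈ Fin 4 ] (i ≢ j ×
      ((x ≡ p i × y ≡ p i ⊕ p j) ⊎ (y ≡ p i × x ≡ p i ⊕ p j)))
  HasShape ang x y = Σ[ i ∈ Fin 4 ] Σ[ j ∈ Fin 4 ] Σ[ k ∈ Fin 4 ]
      (i ≢ j × i ≢ k × j ≢ k × x ≡ p i ⊕ p j × y ≡ p i ⊕ p k)
  HasShape alt x y = Σ[ i ∈ Fin 4 ] Σ[ j ∈ Fin 4 ] Σ[ k ∈ Fin 4 ]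
      (i ≢ j × i ≢ k × j ≢ k ×
      ((x ≡ p i × y ≡ p j ⊕ p k) ⊎ (y ≡ p i × x ≡ p j ⊕ p k)))
  HasShape ax x y = Σ[ i ∈ Fin 4 ] Σ[ j ∈ Fin 4 ] Σ[ k ∈ Fin 4 ] Σ[ l ∈ Fin 4 ]
      (i ≢ j × i ≢ k × i ≢ l × j ≢ k × j ≢ l × k ≢ l ×
       x ≡ p i ⊕ p j × y ≡ p k ⊕ p l)
  HasShape dpt x y = x ≡ y

-- Edges of a pole are its internal edges (Fin nI) and its
-- four dangling edges g₁ g₂ (input connector) h₁ h₂ (output connector).

data Dangle : Set where
  g₁ g₂ h₁ h₂ : Dangle

_≟D_ : DecidableEquality Dangle
g₁ ≟D g₁ = yes _≡_.refl
g₂ ≟D g₂ = yes _≡_.refl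
h₁ ≟D h₁ = yes _≡_.refl
h₂ ≟D h₂ = yes _≡_.refl
g₁ ≟D g₂ = no λ ()
g₁ ≟D h₁ = no λ ()
g₁ ≟D h₂ = no λ ()
g₂ ≟D g₁ = no λ ()
g₂ ≟D h₁ = no λ ()
g₂ ≟D h₂ = no λ ()
h₁ ≟D g₁ = no λ ()
h₁ ≟D g₂ = no λ ()
h₁ ≟D h₂ = no λ ()
h₂ ≟D g₁ = no λ ()
h₂ ≟D g₂ = no λ ()
h₂ ≟D h₁ = no λ ()

Edge : ℕ → Set
Edge m = Fin m ⊎ Dangle

record Pole : Set where
  field
    nV  : ℕ
    nI  : ℕ
    inc : Fin nV → Fin 3 → Edge nI
open Pole public

ΣFin : (n : ℕ) → (Fin n → ℕ) → ℕ
ΣFin zero    f = 0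
ΣFin (suc n) f = f zero + ΣFin n (λ i → f (suc i))

ends : (P : Pole) → Edge (nI P) → ℕ
ends P e = ΣFin (nV P) λ v → ΣFin 3 λ k →
  if ⌊ SumP.≡-dec _≟F_ _≟D_ (inc P v k) e ⌋ then 1 else 0

-- Well-formedness: every internal edge has both ends at vertices
-- (two edge-ends, loops counted twice), every dangling edge has exactly
-- one end at a vertex.
WellFormed : Pole → Set
WellFormed P = ((e : Fin (nI P)) → ends P (inj₁ e) ≡ 2)
             × ((d : Dangle) → ends P (inj₂ d) ≡ 1)

-- Composition M₁ ∘ M₂: h_i of M₁ is joined with g_i of M₂ (i = 1,2).
-- Internal edges of the result: those of M₁, those of M₂, and the two
-- joined edges.

_∘P_ : Pole → Pole → Pole
M₁ ∘P M₂ = record { nV = nV M₁ + nV M₂ ; nI = m₁ + (m₂ + 2) ; inc = inc' }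
  where
  m₁ = nI M₁
  m₂ = nI M₂
  joined : Fin 2 → Edge (m₁ + (m₂ + 2))
  joined k = inj₁ (m₁ ↑ʳ (m₂ ↑ʳ k))
  left : Edge m₁ → Edge (m₁ + (m₂ + 2))
  left (inj₁ e)  = inj₁ (e ↑ˡ (m₂ + 2))
  left (inj₂ g₁) = inj₂ g₁
  left (inj₂ g₂) = inj₂ g₂
  left (inj₂ h₁) = joined zero
  left (inj₂ h₂) = joined (suc zero)
  right : Edge m₂ → Edge (m₁ + (m₂ + 2))
  right (inj₁ e)  = inj₁ (m₁ ↑ʳ (e ↑ˡ 2))
  right (inj₂ g₁) = joined zero
  right (inj₂ g₂) = joined (suc zero)
  right (inj₂ h₁) = inj₂ h₁
  right (inj₂ h₂) = inj₂ h₂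
  inc' : Fin (nV M₁ + nV M₂) → Fin 3 → Edge (m₁ + (m₂ + 2))
  inc' v k with splitAt (nV M₁) v
  ... | inj₁ v₁ = left (inc M₁ v₁ k)
  ... | inj₂ v₂ = right (inc M₂ v₂ k)

module _ (T : Tetrahedron) where

  IsTFlow : (P : Pole) → (Edge (nI P) → Vec4) → Set
  IsTFlow P φ = ((e : Edge (nI P)) → IsPointOf T (φ e))
              × ((v : Fin (nV P)) →
                   IsLineOf T (φ (inc P v zero)) (φ (inc P v (suc zero)))
                              (φ (inc P v (suc (suc zero)))))

  TFlow : Pole → Set
  TFlow P = Σ[ φ ∈ (Edge (nI P) → Vec4) ] IsTFlow P φ

  Transition : Pole → Shape → Shape → Set
  Transition X s t = Σ[ φ ∈ (Edge (nI X) → Vec4) ] (IsTFlow X φ ×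
      HasShape T s (φ (inj₂ g₁)) (φ (inj₂ g₂)) ×
      HasShape T t (φ (inj₂ h₁)) (φ (inj₂ h₂)))

  Collinear : Vec4 → Vec4 → Set
  Collinear x y = HasShape T ls x y ⊎ HasShape T hl x y

  Decollineator : Pole → Set
  Decollineator X = ¬ (Σ[ φ ∈ (Edge (nI X) → Vec4) ] (IsTFlow X φ ×
      Collinear (φ (inj₂ g₁)) (φ (inj₂ g₂)) ×
      Collinear (φ (inj₂ h₁)) (φ (inj₂ h₂))))

  Heavy : Pole → Set
  Heavy X = (φ : Edge (nI X) → Vec4) → IsTFlow X φ →
      Σ[ a ∈ Dangle ] Σ[ b ∈ Dangle ] (a ≢ b ×
        IsMidpoint T (φ (inj₂ a)) × IsMidpoint T (φ (inj₂ b)))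

data InQ : Shape → Shape → Set where
  hl→hl   : InQ hl hl
  ls→ls   : InQ ls ls
  alt→alt : InQ alt alt
  ang→ls  : InQ ang ls
  ls→ang  : InQ ls ang

data Allowed : Shape → Shape → Set where
  ls→ang  : Allowed ls ang
  ang→ls  : Allowed ang ls
  ang→ang : Allowed ang ang
  alt→alt : Allowed alt alt

-- Write the points of T in the basis of its corners.  A T-flow on a
-- well-formed pole conserves the 𝔽₂-sum of its connectors: summing the three
-- values at every vertex counts each internal edge twice and each dangling
-- edge once, while the values at a vertex form a line and add up to 0.  The
-- sum of a pair of points has as many nonzero coordinates as its shape
-- dictates (ls, ang: 2; hl: 1; alt: 3; ax: 4; dpt: 0), so a transition s → u
-- of a decollineator keeps this weight and is not collinear at both ends.
-- Run through the transitions u → v allowed for Q, these two constraints on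
-- s → u and v → t leave only ls → ang, ang → ls, ang → ang and alt → alt,
-- and in each of these at least two dangling edges carry midpoints.

module Submission where

open import Defs
open import Data.Product using (_×_)

open import Algebra.Bundles using (CommutativeMonoid)
open import Algebra.Structures using (IsCommutativeMonoid)
open import Data.Bool using (Bool; true; false; _xor_; if_then_else_)
open import Data.Bool.Properties using (xor-assoc; xor-comm; xor-identityˡ; xor-identityʳ; xor-same)
open import Data.Empty using (⊥-elim)
open import Data.Fin using (Fin; zero; suc; punchIn; _↑ˡ_; _↑ʳ_)
open import Data.Fin.Properties using (all?; punchInᵢ≢i; splitAt-↑ˡ; splitAt-↑ʳ) renaming (_≟_ to _≟F_)
open import Data.Fin.Subset using (∣_∣)
open import Data.Nat using (ℕ; zero; suc)
open import Data.Nat.Properties using () renaming (_≟_ to _≟ℕ_)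
open import Data.Product using (Σ-syntax; _,_; proj₁; proj₂)
open import Data.Sum using (_⊎_; inj₁; inj₂)
open import Data.Sum.Properties using (inj₁-injective; inj₂-injective)
import Data.Sum.Properties as SumP
open import Data.Vec using ([]; _∷_; tabulate)
open import Data.Vec.Properties using (zipWith-assoc; zipWith-comm; zipWith-identityˡ; zipWith-identityʳ; tabulate-cong)
open import Function using (_∘_)
open import Level using (0ℓ)
open import Relation.Binary.PropositionalEquality
  using (_≡_; _≢_; _≗_; refl; sym; trans; cong; cong₂; module ≡-Reasoning)
open import Relation.Binary.PropositionalEquality.Algebra using (isMagma)
open import Relation.Nullary using (¬_; yes; no; ¬?)
open import Relation.Nullary.Decidable using (⌊_⌋; from-yes; _→-dec_)

-- Sums over the edges of a pole

dangle : Fin 4 → Dangle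
dangle zero                   = g₁
dangle (suc zero)             = g₂
dangle (suc (suc zero))       = h₁
dangle (suc (suc (suc zero))) = h₂

dangleIndex : Dangle → Fin 4
dangleIndex g₁ = zero
dangleIndex g₂ = suc zero
dangleIndex h₁ = suc (suc zero)
dangleIndex h₂ = suc (suc (suc zero))

dangle-dangleIndex : ∀ d → dangle (dangleIndex d) ≡ d
dangle-dangleIndex g₁ = refl
dangle-dangleIndex g₂ = refl
dangle-dangleIndex h₁ = refl
dangle-dangleIndex h₂ = refl

dangleIndex-dangle : ∀ i → dangleIndex (dangle i) ≡ i
dangleIndex-dangle zero                   = refl
dangleIndex-dangle (suc zero)             = refl
dangleIndex-dangle (suc (suc zero))       = refl
dangleIndex-dangle (suc (suc (suc zero))) = refl

module Handshake {c ℓ} (M : CommutativeMonoid c ℓ) where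

  open CommutativeMonoid M
    using (Carrier; _≈_; setoid; rawMonoid; monoid; commutativeSemigroup)
    renaming (_∙_ to _+_; ε to 0#; ∙-cong to +-cong; ∙-congˡ to +-congˡ;
              identityˡ to +-identityˡ; identityʳ to +-identityʳ;
              refl to ≈-refl; trans to ≈-trans)
  open import Algebra.Properties.CommutativeMonoid.Sum M
    using (sum; sum-syntax; sum-remove; sum-cong-≋; sum-replicate-zero; ∑-distrib-+)
  open import Algebra.Properties.CommutativeSemigroup commutativeSemigroup using (interchange)
  open import Algebra.Definitions.RawMonoid rawMonoid using () renaming (_×_ to _·_)
  open import Algebra.Properties.Monoid.Mult monoid using (×-homo-+)
  open import Relation.Binary.Reasoning.Setoid setoid

  sum-zero : ∀ {n} (f : Fin n → Carrier) → (∀ i → f i ≈ 0#) → sum f ≈ 0#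
  sum-zero {n} f f≈0 = ≈-trans (sum-cong-≋ f≈0) (sum-replicate-zero n)

  sum-single : ∀ {n} (i : Fin n) (f : Fin n → Carrier) →
               (∀ j → j ≢ i → f j ≈ 0#) → sum f ≈ f i
  sum-single {suc n} i f f≈0 = begin
    sum f                               ≈⟨ sum-remove {i = i} f ⟩
    f i + sum (λ j → f (punchIn i j))   ≈⟨ +-congˡ (sum-zero _ λ j → f≈0 _ (punchInᵢ≢i i j)) ⟩
    f i + 0#                            ≈⟨ +-identityʳ (f i) ⟩
    f i                                 ∎

  ·-ΣFin : ∀ n (f : Fin n → ℕ) x → ΣFin n f · x ≈ ∑[ i < n ] (f i · x)
  ·-ΣFin zero    f x = ≈-refl
  ·-ΣFin (suc n) f x =
    ≈-trans (×-homo-+ x (f zero) _) (+-congˡ (·-ΣFin n (f ∘ suc) x))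

  ∑ᴱ : ∀ {m} → (Edge m → Carrier) → Carrier
  ∑ᴱ {m} f = ∑[ i < m ] f (inj₁ i) + ∑[ i < 4 ] f (inj₂ (dangle i))

  ∑ᴱ-cong : ∀ {m} {f g : Edge m → Carrier} → (∀ e → f e ≈ g e) → ∑ᴱ f ≈ ∑ᴱ g
  ∑ᴱ-cong f≈g = +-cong (sum-cong-≋ (f≈g ∘ inj₁)) (sum-cong-≋ (f≈g ∘ inj₂ ∘ dangle))

  ∑ᴱ-distrib-+ : ∀ {m} (f g : Edge m → Carrier) → ∑ᴱ (λ e → f e + g e) ≈ ∑ᴱ f + ∑ᴱ g
  ∑ᴱ-distrib-+ f g =
    ≈-trans (+-cong (∑-distrib-+ (f ∘ inj₁) (g ∘ inj₁))
                    (∑-distrib-+ (f ∘ inj₂ ∘ dangle) (g ∘ inj₂ ∘ dangle)))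
            (interchange _ _ _ _)

  ∑ᴱ-∑-comm : ∀ {m} n (F : Fin n → Edge m → Carrier) →
              ∑ᴱ (λ e → ∑[ v < n ] F v e) ≈ ∑[ v < n ] ∑ᴱ (F v)
  ∑ᴱ-∑-comm {m} zero    F =
    ≈-trans (+-cong (sum-replicate-zero m) (sum-replicate-zero 4)) (+-identityˡ 0#)
  ∑ᴱ-∑-comm     (suc n) F =
    ≈-trans (∑ᴱ-distrib-+ (F zero) (λ e → ∑[ v < n ] F (suc v) e)) (+-congˡ (∑ᴱ-∑-comm n (F ∘ suc)))

  ∑ᴱ-single : ∀ {m} (x : Edge m) (f : Edge m → Carrier) →
              (∀ e → e ≢ x → f e ≈ 0#) → ∑ᴱ f ≈ f x
  ∑ᴱ-single (inj₁ i) f f≈0 =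
    ≈-trans (+-cong (sum-single i (f ∘ inj₁) λ j j≢i → f≈0 _ (j≢i ∘ inj₁-injective))
                    (sum-zero (f ∘ inj₂ ∘ dangle) λ j → f≈0 _ λ ()))
            (+-identityʳ _)
  ∑ᴱ-single (inj₂ d) f f≈0 = begin
    ∑ᴱ f
      ≈⟨ +-cong (sum-zero (f ∘ inj₁) λ j → f≈0 _ λ ())
                (sum-single (dangleIndex d) (f ∘ inj₂ ∘ dangle) λ j j≢ → f≈0 _ (j≢ ∘ index-of j)) ⟩
    0# + f (inj₂ (dangle (dangleIndex d)))
      ≈⟨ +-identityˡ _ ⟩
    f (inj₂ (dangle (dangleIndex d)))
      ≡⟨ cong (f ∘ inj₂) (dangle-dangleIndex d) ⟩
    f (inj₂ d)
      ∎
    where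
    index-of : ∀ j → inj₂ (dangle j) ≡ inj₂ d → j ≡ dangleIndex d
    index-of j eq = trans (sym (dangleIndex-dangle j)) (cong dangleIndex (inj₂-injective eq))

  ∑ᴱ-indicator : ∀ {m} (x : Edge m) (f : Edge m → Carrier) →
    ∑ᴱ (λ e → (if ⌊ SumP.≡-dec _≟F_ _≟D_ x e ⌋ then 1 else 0) · f e) ≈ f x
  ∑ᴱ-indicator x f = ≈-trans (∑ᴱ-single x _ vanishes) at-x
    where
    vanishes : ∀ e → e ≢ x → (if ⌊ SumP.≡-dec _≟F_ _≟D_ x e ⌋ then 1 else 0) · f e ≈ 0#
    vanishes e e≢x with SumP.≡-dec _≟F_ _≟D_ x e
    ... | yes x≡e = ⊥-elim (e≢x (sym x≡e))
    ... | no _    = ≈-refl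
    at-x : (if ⌊ SumP.≡-dec _≟F_ _≟D_ x x ⌋ then 1 else 0) · f x ≈ f x
    at-x with SumP.≡-dec _≟F_ _≟D_ x x
    ... | yes _   = +-identityʳ (f x)
    ... | no x≢x  = ⊥-elim (x≢x refl)

  handshake : (P : Pole) (φ : Edge (nI P) → Carrier) →
    ∑ᴱ (λ e → ends P e · φ e) ≈ ∑[ v < nV P ] ∑[ k < 3 ] φ (inc P v k)
  handshake P φ = begin
    ∑ᴱ (λ e → ends P e · φ e)
      ≈⟨ ∑ᴱ-cong (λ e → ≈-trans (·-ΣFin (nV P) (λ v → ΣFin 3 λ k → incident v k e) (φ e))
                                 (sum-cong-≋ {nV P} λ v → ·-ΣFin 3 (λ k → incident v k e) (φ e))) ⟩
    ∑ᴱ (λ e → ∑[ v < nV P ] ∑[ k < 3 ] (incident v k e · φ e))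
      ≈⟨ ∑ᴱ-∑-comm (nV P) (λ v e → ∑[ k < 3 ] (incident v k e · φ e)) ⟩
    ∑[ v < nV P ] ∑ᴱ (λ e → ∑[ k < 3 ] (incident v k e · φ e))
      ≈⟨ sum-cong-≋ {nV P} (λ v → ∑ᴱ-∑-comm 3 (λ k e → incident v k e · φ e)) ⟩
    ∑[ v < nV P ] ∑[ k < 3 ] ∑ᴱ (λ e → incident v k e · φ e)
      ≈⟨ sum-cong-≋ {nV P} (λ v → sum-cong-≋ {3} λ k → ∑ᴱ-indicator (inc P v k) φ) ⟩
    ∑[ v < nV P ] ∑[ k < 3 ] φ (inc P v k)
      ∎
    where
    incident : Fin (nV P) → Fin 3 → Edge (nI P) → ℕ
    incident v k e = if ⌊ SumP.≡-dec _≟F_ _≟D_ (inc P v k) e ⌋ then 1 else 0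

-- 𝔽₂⁴ and coordinates in the basis of corners

⊕-isCommutativeMonoid : IsCommutativeMonoid _≡_ _⊕_ 𝟎
⊕-isCommutativeMonoid = record
  { isMonoid = record
    { isSemigroup = record { isMagma = isMagma _⊕_ ; assoc = zipWith-assoc xor-assoc }
    ; identity    = zipWith-identityˡ xor-identityˡ , zipWith-identityʳ xor-identityʳ
    }
  ; comm = zipWith-comm xor-comm
  }

⊕-commutativeMonoid : CommutativeMonoid 0ℓ 0ℓ
⊕-commutativeMonoid = record { isCommutativeMonoid = ⊕-isCommutativeMonoid }

open IsCommutativeMonoid ⊕-isCommutativeMonoid using ()
  renaming (assoc to ⊕-assoc; comm to ⊕-comm; identityˡ to ⊕-identityˡ; identityʳ to ⊕-identityʳ)
open import Algebra.Properties.CommutativeMonoid.Sum ⊕-commutativeMonoid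
  using (sum; sum-syntax; sum-cong-≗; ∑-distrib-+)
open import Algebra.Definitions.RawMonoid (CommutativeMonoid.rawMonoid ⊕-commutativeMonoid)
  using () renaming (_×_ to _·_)
open Handshake ⊕-commutativeMonoid using (sum-zero; sum-single; ∑ᴱ; handshake)

⊕-self : ∀ x → x ⊕ x ≡ 𝟎
⊕-self (a ∷ b ∷ c ∷ d ∷ []) rewrite xor-same a | xor-same b | xor-same c | xor-same d = refl

x⊕y≡𝟎⇒x≡y : ∀ x y → x ⊕ y ≡ 𝟎 → x ≡ y
x⊕y≡𝟎⇒x≡y x y x⊕y≡𝟎 = begin
  x              ≡⟨ ⊕-identityʳ x ⟨
  x ⊕ 𝟎          ≡⟨ cong (x ⊕_) (⊕-self y) ⟨
  x ⊕ (y ⊕ y)    ≡⟨ ⊕-assoc x y y ⟨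
  (x ⊕ y) ⊕ y    ≡⟨ cong (_⊕ y) x⊕y≡𝟎 ⟩
  𝟎 ⊕ y          ≡⟨ ⊕-identityˡ y ⟩
  y              ∎
  where open ≡-Reasoning

x⊕[y⊕[x⊕y]]≡𝟎 : ∀ x y → x ⊕ (y ⊕ (x ⊕ y)) ≡ 𝟎
x⊕[y⊕[x⊕y]]≡𝟎 x y = trans (sym (⊕-assoc x y (x ⊕ y))) (⊕-self (x ⊕ y))

Coords : Set
Coords = Fin 4 → Bool

_⊻_ : Coords → Coords → Coords
(a ⊻ b) i = a i xor b i

δ : Fin 4 → Coords
δ i j = ⌊ i ≟F j ⌋

scale : Bool → Vec4 → Vec4
scale b v = if b then v else 𝟎

scale-xor : ∀ a b v → scale (a xor b) v ≡ scale a v ⊕ scale b v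
scale-xor false b v = sym (⊕-identityˡ _)
scale-xor true false v = sym (⊕-identityʳ v)
scale-xor true true v = sym (⊕-self v)

lincomb-∑ : ∀ c v → lincomb c v ≡ ∑[ i < 4 ] scale (c i) (v i)
lincomb-∑ c v = cong (λ w → s₀ ⊕ (s₁ ⊕ (s₂ ⊕ w))) (sym (⊕-identityʳ _))
  where
  s₀ = scale (c zero) (v zero)
  s₁ = scale (c (suc zero)) (v (suc zero))
  s₂ = scale (c (suc (suc zero))) (v (suc (suc zero)))

lincomb-⊻ : ∀ a b v → lincomb (a ⊻ b) v ≡ lincomb a v ⊕ lincomb b v
lincomb-⊻ a b v = begin
  lincomb (a ⊻ b) v
    ≡⟨ lincomb-∑ (a ⊻ b) v ⟩
  ∑[ i < 4 ] scale (a i xor b i) (v i)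
    ≡⟨ sum-cong-≗ (λ i → scale-xor (a i) (b i) (v i)) ⟩
  ∑[ i < 4 ] (scale (a i) (v i) ⊕ scale (b i) (v i))
    ≡⟨ ∑-distrib-+ (λ i → scale (a i) (v i)) (λ i → scale (b i) (v i)) ⟩
  (∑[ i < 4 ] scale (a i) (v i)) ⊕ (∑[ i < 4 ] scale (b i) (v i))
    ≡⟨ cong₂ _⊕_ (lincomb-∑ a v) (lincomb-∑ b v) ⟨
  lincomb a v ⊕ lincomb b v
    ∎
  where open ≡-Reasoning

lincomb-δ : ∀ i v → lincomb (δ i) v ≡ v i
lincomb-δ i v = trans (lincomb-∑ (δ i) v) (trans (sum-single i _ off-i) at-i)
  where
  off-i : ∀ j → j ≢ i → scale (δ i j) (v j) ≡ 𝟎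
  off-i j j≢i with i ≟F j
  ... | yes i≡j = ⊥-elim (j≢i (sym i≡j))
  ... | no _    = refl
  at-i : scale (δ i i) (v i) ≡ v i
  at-i with i ≟F i
  ... | yes _   = refl
  ... | no i≢i  = ⊥-elim (i≢i refl)

xor≡false⇒≡ : ∀ x y → x xor y ≡ false → x ≡ y
xor≡false⇒≡ false false _ = refl
xor≡false⇒≡ true  true  _ = refl

lincomb-injective : ∀ (T : Tetrahedron) {a b} →
  lincomb a (corner T) ≡ lincomb b (corner T) → a ≗ b
lincomb-injective T {a} {b} eq i = xor≡false⇒≡ (a i) (b i) (indep T (a ⊻ b) sum≡𝟎 i)
  where
  sum≡𝟎 : lincomb (a ⊻ b) (corner T) ≡ 𝟎
  sum≡𝟎 = trans (lincomb-⊻ a b (corner T)) (trans (cong (_⊕ lincomb b (corner T)) eq) (⊕-self _))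

weight : Coords → ℕ
weight c = ∣ tabulate c ∣

weight-cong : ∀ {a b} → a ≗ b → weight a ≡ weight b
weight-cong a≗b = cong ∣_∣ (tabulate-cong a≗b)

weight-ls : ∀ i j → i ≢ j → weight (δ i ⊻ δ j) ≡ 2
weight-ls = from-yes (all? λ i → all? λ j → ¬? (i ≟F j) →-dec weight (δ i ⊻ δ j) ≟ℕ 2)

weight-hl : ∀ i j → i ≢ j → weight (δ i ⊻ (δ i ⊻ δ j)) ≡ 1
weight-hl = from-yes (all? λ i → all? λ j → ¬? (i ≟F j) →-dec weight (δ i ⊻ (δ i ⊻ δ j)) ≟ℕ 1)

weight-ang : ∀ i j k → i ≢ j → i ≢ k → j ≢ k → weight ((δ i ⊻ δ j) ⊻ (δ i ⊻ δ k)) ≡ 2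
weight-ang = from-yes (all? λ i → all? λ j → all? λ k →
  ¬? (i ≟F j) →-dec ¬? (i ≟F k) →-dec ¬? (j ≟F k) →-dec weight ((δ i ⊻ δ j) ⊻ (δ i ⊻ δ k)) ≟ℕ 2)

weight-alt : ∀ i j k → i ≢ j → i ≢ k → j ≢ k → weight (δ i ⊻ (δ j ⊻ δ k)) ≡ 3
weight-alt = from-yes (all? λ i → all? λ j → all? λ k →
  ¬? (i ≟F j) →-dec ¬? (i ≟F k) →-dec ¬? (j ≟F k) →-dec weight (δ i ⊻ (δ j ⊻ δ k)) ≟ℕ 3)

weight-ax : ∀ i j k l → i ≢ j → i ≢ k → i ≢ l → j ≢ k → j ≢ l → k ≢ l →
            weight ((δ i ⊻ δ j) ⊻ (δ k ⊻ δ l)) ≡ 4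
weight-ax = from-yes (all? λ i → all? λ j → all? λ k → all? λ l →
  ¬? (i ≟F j) →-dec ¬? (i ≟F k) →-dec ¬? (i ≟F l) →-dec ¬? (j ≟F k) →-dec ¬? (j ≟F l) →-dec ¬? (k ≟F l) →-dec
  weight ((δ i ⊻ δ j) ⊻ (δ k ⊻ δ l)) ≟ℕ 4)

-- Shapes of pairs of points

shapeWeight : Shape → ℕ
shapeWeight ls  = 2
shapeWeight hl  = 1
shapeWeight ang = 2
shapeWeight alt = 3
shapeWeight ax  = 4
shapeWeight dpt = 0

module _ (T : Tetrahedron) where
  private p = corner T

  HasCoords : Vec4 → Coords → Set
  HasCoords x c = x ≡ lincomb c p

  corner-coords : ∀ i → HasCoords (p i) (δ i)
  corner-coords i = sym (lincomb-δ i p)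

  ⊕-coords : ∀ {x y} a b → HasCoords x a → HasCoords y b → HasCoords (x ⊕ y) (a ⊻ b)
  ⊕-coords a b x≡ y≡ = trans (cong₂ _⊕_ x≡ y≡) (sym (lincomb-⊻ a b p))

  midpoint-coords : ∀ i j → HasCoords (p i ⊕ p j) (δ i ⊻ δ j)
  midpoint-coords i j = ⊕-coords (δ i) (δ j) (corner-coords i) (corner-coords j)

  corner-midpoint-coords : ∀ i j k → HasCoords (p i ⊕ (p j ⊕ p k)) (δ i ⊻ (δ j ⊻ δ k))
  corner-midpoint-coords i j k = ⊕-coords (δ i) (δ j ⊻ δ k) (corner-coords i) (midpoint-coords j k)

  midpoints-coords : ∀ i j k l → HasCoords ((p i ⊕ p j) ⊕ (p k ⊕ p l)) ((δ i ⊻ δ j) ⊻ (δ k ⊻ δ l))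
  midpoints-coords i j k l =
    ⊕-coords (δ i ⊻ δ j) (δ k ⊻ δ l) (midpoint-coords i j) (midpoint-coords k l)

  swap-coords : ∀ {x y} c → HasCoords (y ⊕ x) c → HasCoords (x ⊕ y) c
  swap-coords {x} {y} c = trans (⊕-comm x y)

  pair-sum-coords : ∀ {s x y} → HasShape T s x y →
    Σ[ c ∈ Coords ] (HasCoords (x ⊕ y) c × weight c ≡ shapeWeight s)
  pair-sum-coords {ls} (i , j , i≢j , refl , refl) =
    δ i ⊻ δ j , midpoint-coords i j , weight-ls i j i≢j
  pair-sum-coords {hl} (i , j , i≢j , inj₁ (refl , refl)) =
    δ i ⊻ (δ i ⊻ δ j) , corner-midpoint-coords i i j , weight-hl i j i≢j
  pair-sum-coords {hl} (i , j , i≢j , inj₂ (refl , refl)) =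
    δ i ⊻ (δ i ⊻ δ j) , swap-coords (δ i ⊻ (δ i ⊻ δ j)) (corner-midpoint-coords i i j) , weight-hl i j i≢j
  pair-sum-coords {ang} (i , j , k , i≢j , i≢k , j≢k , refl , refl) =
    (δ i ⊻ δ j) ⊻ (δ i ⊻ δ k) , midpoints-coords i j i k , weight-ang i j k i≢j i≢k j≢k
  pair-sum-coords {alt} (i , j , k , i≢j , i≢k , j≢k , inj₁ (refl , refl)) =
    δ i ⊻ (δ j ⊻ δ k) , corner-midpoint-coords i j k , weight-alt i j k i≢j i≢k j≢k
  pair-sum-coords {alt} (i , j , k , i≢j , i≢k , j≢k , inj₂ (refl , refl)) =
    δ i ⊻ (δ j ⊻ δ k) , swap-coords (δ i ⊻ (δ j ⊻ δ k)) (corner-midpoint-coords i j k) , weight-alt i j k i≢j i≢k j≢k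
  pair-sum-coords {ax} (i , j , k , l , i≢j , i≢k , i≢l , j≢k , j≢l , k≢l , refl , refl) =
    (δ i ⊻ δ j) ⊻ (δ k ⊻ δ l) , midpoints-coords i j k l , weight-ax i j k l i≢j i≢k i≢l j≢k j≢l k≢l
  pair-sum-coords {dpt} {x} refl = (λ _ → false) , ⊕-self x , refl

  shapeWeight-≡ : ∀ {s s' x y x' y'} → HasShape T s x y → HasShape T s' x' y' →
                  x ⊕ y ≡ x' ⊕ y' → shapeWeight s ≡ shapeWeight s'
  shapeWeight-≡ {s} {s'} h h' sums≡ with pair-sum-coords h | pair-sum-coords h'
  ... | c , x+y≡c , wc | c′ , x′+y′≡c′ , wc′ = begin
    shapeWeight s   ≡⟨ wc ⟨
    weight c        ≡⟨ weight-cong {c} {c′} (lincomb-injective T (trans (sym x+y≡c) (trans sums≡ x′+y′≡c′))) ⟩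
    weight c′       ≡⟨ wc′ ⟩
    shapeWeight s'  ∎
    where open ≡-Reasoning

  HasShape-sym : ∀ {s x y} → HasShape T s x y → HasShape T s y x
  HasShape-sym {ls} (i , j , i≢j , x≡ , y≡) = j , i , i≢j ∘ sym , y≡ , x≡
  HasShape-sym {hl} (i , j , i≢j , inj₁ xy) = i , j , i≢j , inj₂ xy
  HasShape-sym {hl} (i , j , i≢j , inj₂ yx) = i , j , i≢j , inj₁ yx
  HasShape-sym {ang} (i , j , k , i≢j , i≢k , j≢k , x≡ , y≡) = i , k , j , i≢k , i≢j , j≢k ∘ sym , y≡ , x≡
  HasShape-sym {alt} (i , j , k , i≢j , i≢k , j≢k , inj₁ xy) = i , j , k , i≢j , i≢k , j≢k , inj₂ xy
  HasShape-sym {alt} (i , j , k , i≢j , i≢k , j≢k , inj₂ yx) = i , j , k , i≢j , i≢k , j≢k , inj₁ yx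
  HasShape-sym {ax} (i , j , k , l , i≢j , i≢k , i≢l , j≢k , j≢l , k≢l , x≡ , y≡) =
    k , l , i , j , k≢l , i≢k ∘ sym , j≢k ∘ sym , i≢l ∘ sym , j≢l ∘ sym , i≢j , y≡ , x≡
  HasShape-sym {dpt} x≡y = sym x≡y

  private
    ⊕-swap : ∀ {x} a b → x ≡ p a ⊕ p b → x ≡ p b ⊕ p a
    ⊕-swap a b x≡ = trans x≡ (⊕-comm (p a) (p b))

  corner-midpoint-shape : ∀ {x y} i → x ≡ p i → IsMidpoint T y → Σ[ s ∈ Shape ] HasShape T s x y
  corner-midpoint-shape i x≡ (j , k , j≢k , y≡) with i ≟F j | i ≟F k
  ... | yes refl | _        = hl , i , k , j≢k , inj₁ (x≡ , y≡)
  ... | no _     | yes refl = hl , i , j , j≢k ∘ sym , inj₁ (x≡ , ⊕-swap j i y≡)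
  ... | no i≢j   | no i≢k   = alt , i , j , k , i≢j , i≢k , j≢k , inj₁ (x≡ , y≡)

  midpoint-shape : ∀ {x y} → IsMidpoint T x → IsMidpoint T y → Σ[ s ∈ Shape ] HasShape T s x y
  midpoint-shape (i , j , i≢j , x≡) (k , l , k≢l , y≡) with i ≟F k | i ≟F l | j ≟F k | j ≟F l
  ... | yes refl | _        | _        | yes refl = dpt , trans x≡ (sym y≡)
  ... | yes refl | _        | _        | no j≢l   = ang , i , j , l , i≢j , k≢l , j≢l , x≡ , y≡
  ... | no _     | yes refl | yes refl | _        = dpt , trans x≡ (sym (⊕-swap k i y≡))
  ... | no _     | yes refl | no j≢k   | _        = ang , i , j , k , i≢j , k≢l ∘ sym , j≢k , x≡ , ⊕-swap k i y≡
  ... | no i≢k   | no i≢l   | yes refl | _        = ang , j , i , l , i≢j ∘ sym , k≢l , i≢l , ⊕-swap i j x≡ , y≡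
  ... | no i≢k   | no _     | no _     | yes refl = ang , j , i , k , i≢j ∘ sym , k≢l ∘ sym , i≢k , ⊕-swap i j x≡ , ⊕-swap k j y≡
  ... | no i≢k   | no i≢l   | no j≢k   | no j≢l   = ax , i , j , k , l , i≢j , i≢k , i≢l , j≢k , j≢l , k≢l , x≡ , y≡

  pair-shape : ∀ {x y} → IsPointOf T x → IsPointOf T y → Σ[ s ∈ Shape ] HasShape T s x y
  pair-shape (inj₁ (i , x≡)) (inj₁ (j , y≡)) with i ≟F j
  ... | yes refl = dpt , trans x≡ (sym y≡)
  ... | no i≢j   = ls , i , j , i≢j , x≡ , y≡
  pair-shape (inj₁ (i , x≡)) (inj₂ my) = corner-midpoint-shape i x≡ my
  pair-shape (inj₂ mx) (inj₁ (j , y≡)) with corner-midpoint-shape j y≡ mx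
  ... | s , h = s , HasShape-sym h
  pair-shape (inj₂ mx) (inj₂ my) = midpoint-shape mx my

  line-sum : ∀ {a b c} → IsLineOf T a b c → a ⊕ (b ⊕ c) ≡ 𝟎
  line-sum (i , j , _ , inj₁ (refl , refl , refl))        = ⊕-self (p i ⊕ p j)
  line-sum (i , j , _ , inj₂ (inj₁ (refl , refl , refl))) =
    trans (cong (p i ⊕_) (⊕-comm (p i ⊕ p j) (p j))) (x⊕[y⊕[x⊕y]]≡𝟎 (p i) (p j))
  line-sum (i , j , _ , inj₂ (inj₂ (refl , refl , refl))) = x⊕[y⊕[x⊕y]]≡𝟎 (p i) (p j)

  dangling-sum-zero : ∀ (P : Pole) {φ} → WellFormed P → IsTFlow T P φ →
                      ∑[ i < 4 ] φ (inj₂ (dangle i)) ≡ 𝟎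
  dangling-sum-zero P {φ} (internal-ends , dangling-ends) (_ , lines) = begin
    ∑[ i < 4 ] φ (inj₂ (dangle i))
      ≡⟨ ⊕-identityˡ _ ⟨
    𝟎 ⊕ (∑[ i < 4 ] φ (inj₂ (dangle i)))
      ≡⟨ cong₂ _⊕_ (sum-zero _ internal-vanishes) (sum-cong-≗ dangling-survives) ⟨
    ∑ᴱ (λ e → ends P e · φ e)
      ≡⟨ handshake P φ ⟩
    ∑[ v < nV P ] ∑[ k < 3 ] φ (inc P v k)
      ≡⟨ sum-zero _ vertex-vanishes ⟩
    𝟎 ∎
    where
    open ≡-Reasoning
    internal-vanishes : ∀ i → ends P (inj₁ i) · φ (inj₁ i) ≡ 𝟎
    internal-vanishes i rewrite internal-ends i =
      trans (cong (φ (inj₁ i) ⊕_) (⊕-identityʳ _)) (⊕-self _)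
    dangling-survives : ∀ i → ends P (inj₂ (dangle i)) · φ (inj₂ (dangle i)) ≡ φ (inj₂ (dangle i))
    dangling-survives i rewrite dangling-ends (dangle i) = ⊕-identityʳ _
    vertex-vanishes : ∀ v → ∑[ k < 3 ] φ (inc P v k) ≡ 𝟎
    vertex-vanishes v =
      trans (cong (λ w → φ (inc P v zero) ⊕ (φ (inc P v (suc zero)) ⊕ w)) (⊕-identityʳ _))
            (line-sum (lines v))

  flow-conservation : ∀ (P : Pole) {φ} → WellFormed P → IsTFlow T P φ →
                      φ (inj₂ g₁) ⊕ φ (inj₂ g₂) ≡ φ (inj₂ h₁) ⊕ φ (inj₂ h₂)
  flow-conservation P {φ} wf flow = x⊕y≡𝟎⇒x≡y _ _ (begin
    (φ (inj₂ g₁) ⊕ φ (inj₂ g₂)) ⊕ (φ (inj₂ h₁) ⊕ φ (inj₂ h₂))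
      ≡⟨ ⊕-assoc _ _ _ ⟩
    φ (inj₂ g₁) ⊕ (φ (inj₂ g₂) ⊕ (φ (inj₂ h₁) ⊕ φ (inj₂ h₂)))
      ≡⟨ cong (λ w → φ (inj₂ g₁) ⊕ (φ (inj₂ g₂) ⊕ (φ (inj₂ h₁) ⊕ w))) (⊕-identityʳ _) ⟨
    ∑[ i < 4 ] φ (inj₂ (dangle i))
      ≡⟨ dangling-sum-zero P wf flow ⟩
    𝟎 ∎)
    where open ≡-Reasoning

-- Composition of poles

-- The edge embeddings of the definition of _∘P_, which are local to it there.
module _ (M₁ M₂ : Pole) where
  private
    m₁ = nI M₁
    m₂ = nI M₂

  joinedEdge : Fin 2 → Edge (nI (M₁ ∘P M₂))
  joinedEdge k = inj₁ (m₁ ↑ʳ (m₂ ↑ʳ k))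

  leftEdge : Edge m₁ → Edge (nI (M₁ ∘P M₂))
  leftEdge (inj₁ e)  = inj₁ (e ↑ˡ _)
  leftEdge (inj₂ g₁) = inj₂ g₁
  leftEdge (inj₂ g₂) = inj₂ g₂
  leftEdge (inj₂ h₁) = joinedEdge zero
  leftEdge (inj₂ h₂) = joinedEdge (suc zero)

  rightEdge : Edge m₂ → Edge (nI (M₁ ∘P M₂))
  rightEdge (inj₁ e)  = inj₁ (m₁ ↑ʳ (e ↑ˡ _))
  rightEdge (inj₂ g₁) = joinedEdge zero
  rightEdge (inj₂ g₂) = joinedEdge (suc zero)
  rightEdge (inj₂ h₁) = inj₂ h₁
  rightEdge (inj₂ h₂) = inj₂ h₂

  inc-∘ˡ : ∀ v k → inc (M₁ ∘P M₂) (v ↑ˡ nV M₂) k ≡ leftEdge (inc M₁ v k)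
  inc-∘ˡ v k rewrite splitAt-↑ˡ (nV M₁) v (nV M₂) with inc M₁ v k
  ... | inj₁ _  = refl
  ... | inj₂ g₁ = refl
  ... | inj₂ g₂ = refl
  ... | inj₂ h₁ = refl
  ... | inj₂ h₂ = refl

  inc-∘ʳ : ∀ v k → inc (M₁ ∘P M₂) (nV M₁ ↑ʳ v) k ≡ rightEdge (inc M₂ v k)
  inc-∘ʳ v k rewrite splitAt-↑ʳ (nV M₁) (nV M₂) v with inc M₂ v k
  ... | inj₁ _  = refl
  ... | inj₂ g₁ = refl
  ... | inj₂ g₂ = refl
  ... | inj₂ h₁ = refl
  ... | inj₂ h₂ = refl

module _ (T : Tetrahedron) where

  IsLineOf-cong : ∀ {a a′ b b′ c c′} → a ≡ a′ → b ≡ b′ → c ≡ c′ → IsLineOf T a b c → IsLineOf T a′ b′ c′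
  IsLineOf-cong refl refl refl line = line

  module _ (M₁ M₂ : Pole) {φ : Edge (nI (M₁ ∘P M₂)) → Vec4} (flow : IsTFlow T (M₁ ∘P M₂) φ) where

    restrictˡ : IsTFlow T M₁ (φ ∘ leftEdge M₁ M₂)
    restrictˡ = proj₁ flow ∘ leftEdge M₁ M₂ , λ v →
      IsLineOf-cong (at v zero) (at v (suc zero)) (at v (suc (suc zero))) (proj₂ flow (v ↑ˡ nV M₂))
      where
      at : ∀ v k → φ (inc (M₁ ∘P M₂) (v ↑ˡ nV M₂) k) ≡ φ (leftEdge M₁ M₂ (inc M₁ v k))
      at v k = cong φ (inc-∘ˡ M₁ M₂ v k)

    restrictʳ : IsTFlow T M₂ (φ ∘ rightEdge M₁ M₂)
    restrictʳ = proj₁ flow ∘ rightEdge M₁ M₂ , λ v →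
      IsLineOf-cong (at v zero) (at v (suc zero)) (at v (suc (suc zero))) (proj₂ flow (nV M₁ ↑ʳ v))
      where
      at : ∀ v k → φ (inc (M₁ ∘P M₂) (nV M₁ ↑ʳ v) k) ≡ φ (rightEdge M₁ M₂ (inc M₂ v k))
      at v k = cong φ (inc-∘ʳ M₁ M₂ v k)

  transition-∘ : ∀ M₁ M₂ {s t} → Transition T (M₁ ∘P M₂) s t →
                 Σ[ u ∈ Shape ] (Transition T M₁ s u × Transition T M₂ u t)
  transition-∘ M₁ M₂ (φ , flow , hs , ht)
    with pair-shape T (proj₁ flow (joinedEdge M₁ M₂ zero)) (proj₁ flow (joinedEdge M₁ M₂ (suc zero)))
  ... | u , hu = u , (φ ∘ leftEdge M₁ M₂ , restrictˡ M₁ M₂ flow , hs , hu)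
                   , (φ ∘ rightEdge M₁ M₂ , restrictʳ M₁ M₂ flow , hu , ht)

-- Transitions

data CollinearShape : Shape → Set where
  ls-collinear : CollinearShape ls
  hl-collinear : CollinearShape hl

DecollinearShapes : Shape → Shape → Set
DecollinearShapes s u = shapeWeight s ≡ shapeWeight u × ¬ (CollinearShape s × CollinearShape u)

collinear-shape : ∀ T {s x y} → CollinearShape s → HasShape T s x y → Collinear T x y
collinear-shape T ls-collinear h = inj₁ h
collinear-shape T hl-collinear h = inj₂ h

decollineator-shapes : ∀ T D {s u} → WellFormed D → Decollineator T D →
                       Transition T D s u → DecollinearShapes s u
decollineator-shapes T D wf decol (φ , flow , hs , hu) =
  shapeWeight-≡ T hs hu (flow-conservation T D wf flow) ,
  λ (cs , cu) → decol (φ , flow , collinear-shape T cs hs , collinear-shape T cu hu)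

shapeWeight≡1⇒hl : ∀ {s} → shapeWeight s ≡ 1 → s ≡ hl
shapeWeight≡1⇒hl {hl}  _ = refl
shapeWeight≡1⇒hl {ls}  ()
shapeWeight≡1⇒hl {ang} ()
shapeWeight≡1⇒hl {alt} ()
shapeWeight≡1⇒hl {ax}  ()
shapeWeight≡1⇒hl {dpt} ()

shapeWeight≡2⇒ls⊎ang : ∀ {s} → shapeWeight s ≡ 2 → s ≡ ls ⊎ s ≡ ang
shapeWeight≡2⇒ls⊎ang {ls}  _ = inj₁ refl
shapeWeight≡2⇒ls⊎ang {ang} _ = inj₂ refl
shapeWeight≡2⇒ls⊎ang {hl}  ()
shapeWeight≡2⇒ls⊎ang {alt} ()
shapeWeight≡2⇒ls⊎ang {ax}  ()
shapeWeight≡2⇒ls⊎ang {dpt} ()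

shapeWeight≡3⇒alt : ∀ {s} → shapeWeight s ≡ 3 → s ≡ alt
shapeWeight≡3⇒alt {alt} _ = refl
shapeWeight≡3⇒alt {ls}  ()
shapeWeight≡3⇒alt {hl}  ()
shapeWeight≡3⇒alt {ang} ()
shapeWeight≡3⇒alt {ax}  ()
shapeWeight≡3⇒alt {dpt} ()

shapeWeight≡2⇒ang : ∀ {s} → shapeWeight s ≡ 2 → ¬ CollinearShape s → s ≡ ang
shapeWeight≡2⇒ang w≡2 ¬col with shapeWeight≡2⇒ls⊎ang w≡2
... | inj₁ refl = ⊥-elim (¬col ls-collinear)
... | inj₂ refl = refl

composite-allowed : ∀ {s u v t} →
  DecollinearShapes s u → InQ u v → DecollinearShapes v t → Allowed s t
composite-allowed (s≈u , ¬col₁) hl→hl _ with shapeWeight≡1⇒hl s≈u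
... | refl = ⊥-elim (¬col₁ (hl-collinear , hl-collinear))
composite-allowed (s≈u , _) alt→alt (v≈t , _)
  with shapeWeight≡3⇒alt s≈u | shapeWeight≡3⇒alt (sym v≈t)
... | refl | refl = alt→alt
composite-allowed (s≈u , ¬col₁) ls→ls (v≈t , ¬col₂)
  with shapeWeight≡2⇒ang s≈u (λ cs → ¬col₁ (cs , ls-collinear))
     | shapeWeight≡2⇒ang (sym v≈t) (λ ct → ¬col₂ (ls-collinear , ct))
... | refl | refl = ang→ang
composite-allowed (s≈u , _) ang→ls (v≈t , ¬col₂)
  with shapeWeight≡2⇒ls⊎ang s≈u | shapeWeight≡2⇒ang (sym v≈t) (λ ct → ¬col₂ (ls-collinear , ct))
... | inj₁ refl | refl = ls→ang
... | inj₂ refl | refl = ang→ang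
composite-allowed (s≈u , ¬col₁) ls→ang (v≈t , _)
  with shapeWeight≡2⇒ang s≈u (λ cs → ¬col₁ (cs , ls-collinear)) | shapeWeight≡2⇒ls⊎ang (sym v≈t)
... | refl | inj₁ refl = ang→ls
... | refl | inj₂ refl = ang→ang

module _ (T : Tetrahedron) where

  ang-midpoints : ∀ {x y} → HasShape T ang x y → IsMidpoint T x × IsMidpoint T y
  ang-midpoints (i , j , k , i≢j , i≢k , _ , x≡ , y≡) = (i , j , i≢j , x≡) , (i , k , i≢k , y≡)

  alt-midpoint : ∀ {x y} → HasShape T alt x y → IsMidpoint T x ⊎ IsMidpoint T y
  alt-midpoint (_ , j , k , _ , _ , j≢k , inj₁ (_ , y≡)) = inj₂ (j , k , j≢k , y≡)
  alt-midpoint (_ , j , k , _ , _ , j≢k , inj₂ (_ , x≡)) = inj₁ (j , k , j≢k , x≡)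

  allowed⇒heavy : ∀ X → (∀ s t → Transition T X s t → Allowed s t) → Heavy T X
  allowed⇒heavy X allowed φ flow = by-transition (allowed s t (φ , flow , hs , ht)) hs ht
    where
    shape-of : ∀ a b → Σ[ s ∈ Shape ] HasShape T s (φ (inj₂ a)) (φ (inj₂ b))
    shape-of a b = pair-shape T (proj₁ flow (inj₂ a)) (proj₁ flow (inj₂ b))
    s = proj₁ (shape-of g₁ g₂)
    hs = proj₂ (shape-of g₁ g₂)
    t = proj₁ (shape-of h₁ h₂)
    ht = proj₂ (shape-of h₁ h₂)
    by-transition : ∀ {s t} → Allowed s t →
      HasShape T s (φ (inj₂ g₁)) (φ (inj₂ g₂)) → HasShape T t (φ (inj₂ h₁)) (φ (inj₂ h₂)) →
      Σ[ a ∈ Dangle ] Σ[ b ∈ Dangle ] (a ≢ b × IsMidpoint T (φ (inj₂ a)) × IsMidpoint T (φ (inj₂ b)))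
    by-transition ls→ang  _  ht = h₁ , h₂ , (λ ()) , ang-midpoints ht
    by-transition ang→ls  hs _  = g₁ , g₂ , (λ ()) , ang-midpoints hs
    by-transition ang→ang hs _  = g₁ , g₂ , (λ ()) , ang-midpoints hs
    by-transition alt→alt hs ht with alt-midpoint hs | alt-midpoint ht
    ... | inj₁ a | inj₁ b = g₁ , h₁ , (λ ()) , a , b
    ... | inj₁ a | inj₂ b = g₁ , h₂ , (λ ()) , a , b
    ... | inj₂ a | inj₁ b = g₂ , h₁ , (λ ()) , a , b
    ... | inj₂ a | inj₂ b = g₂ , h₂ , (λ ()) , a , b

-- Flow conservation is needed for the decollineators only, so Q need not be well formed.
proposition4p2 : (T : Tetrahedron) (D₁ Q D₂ : Pole) →
    WellFormed D₁ → WellFormed Q → WellFormed D₂ →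
    Decollineator T D₁ → Decollineator T D₂ →
    ((s t : Shape) → Transition T Q s t → InQ s t) →
    ((s t : Shape) → Transition T ((D₁ ∘P Q) ∘P D₂) s t → Allowed s t)
    × Heavy T ((D₁ ∘P Q) ∘P D₂)
proposition4p2 T D₁ Q D₂ wf₁ _ wf₂ decol₁ decol₂ Q-transitions =
  transitions , allowed⇒heavy T ((D₁ ∘P Q) ∘P D₂) transitions
  where
  transitions : ∀ s t → Transition T ((D₁ ∘P Q) ∘P D₂) s t → Allowed s t
  transitions s t tr with transition-∘ T (D₁ ∘P Q) D₂ tr
  ... | v , tr₁Q , tr₂ with transition-∘ T D₁ Q tr₁Q
  ... | u , tr₁ , trQ =
    composite-allowed (decollineator-shapes T D₁ wf₁ decol₁ tr₁)
                      (Q-transitions u v trQ)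
                      (decollineator-shapes T D₂ wf₂ decol₂ tr₂)
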